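{- Let $\mathcal{M}$ be a meadow and $T$ a regular thread. Then for all $n\in\mathbb{N}$ and all $\alpha\in R^{\mathcal{M}}_{T,n}$: (1) $\pi_{n+1}(T)\bullet\alpha\neq\mathsf{D}$, and (2) for all $k>n$, $\pi_k(T)\bullet\alpha=\pi_{n+1}(T)\bullet\alpha$.
   Context: A meadow is a commutative ring with unit with a total unary $x\mapsto x^{ -1}$ satisfying $(x^{ -1})^{ -1}=x$ and $x\cdot(x\cdot x^{ -1})=x$. Variables $\mathit{Var}$: input $x_0,x_1,\dots$, auxiliary $a_0,a_1,\dots$, output $y$. Actions: assignments $a_i.\mathtt{cp}(x_j)$, $a_i.\mathtt{set{:}0}$, $a_i.\mathtt{set{:}1}$, $a_i.\mathtt{set{:}ai}$, $a_i.\mathtt{set{:}mi}$, $a_i.\mathtt{set{:}a}(a_j)$, $a_i.\mathtt{set{:}m}(a_j)$, $y.\mathtt{cp}(a_j)$ and tests $a_i.\mathtt{test{:}0}$. Each assignment $\mathtt{a}$ has an effect $\alpha\mapsto\alpha'$ on states $\alpha\in\mathcal{M}^{\mathit{Var}}$ (writing $\alpha[v:=m]$ for reassignment): $a_i.\mathtt{cp}(x_j)$: $\alpha[a_i:=\alpha(x_j)]$; $a_i.\mathtt{set{:}0}$: $\alpha[a_i:=0]$; $a_i.\mathtt{set{:}1}$: $\alpha[a_i:=1]$; $a_i.\mathtt{set{:}ai}$: $\alpha[a_i:=-\alpha(a_i)]$; $a_i.\mathtt{set{:}mi}$: $\alpha[a_i:=\alpha(a_i)^{ -1}]$; $a_i.\mathtt{set{:}a}(a_j)$: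 $\alpha[a_i:=\alpha(a_i)+\alpha(a_j)]$; $a_i.\mathtt{set{:}m}(a_j)$: $\alpha[a_i:=\alpha(a_i)\cdot\alpha(a_j)]$; $y.\mathtt{cp}(a_j)$: $\alpha[y:=\alpha(a_j)]$. Threads are (possibly infinite) binary trees: $\mathsf{S}$, $\mathsf{D}$, or $T_1\trianglelefteq\mathtt{a}\trianglerighteq T_2$; $\mathtt{a}\circ T$ abbreviates $T\trianglelefteq\mathtt{a}\trianglerighteq T$; assignments occur only as $\mathtt{a}\circ T$. Regular: finitely many distinct subthreads. $\pi_0(T)=\mathsf{D}$, $\pi_{n+1}(\mathsf{S})=\mathsf{S}$, $\pi_{n+1}(\mathsf{D})=\mathsf{D}$, $\pi_{n+1}(T_1\trianglelefteq\mathtt{a}\trianglerighteq T_2)=\pi_n(T_1)\trianglelefteq\mathtt{a}\trianglerighteq\pi_n(T_2)$. Apply operator for finite threads $T$ on $\mathcal{M}^{\mathit{Var}}\cup\{\mathsf{D}\}$: $T\bullet\mathsf{D}=\mathsf{D}$, $\mathsf{S}\bullet\alpha=\alpha$, $\mathsf{D}\bullet\alpha=\mathsf{D}$, $(\mathtt{a}\circ T)\bullet\alpha=T\bullet\alpha'$ for an assignment $\mathtt{a}$, and $(T_1\trianglelefteq a_i.\mathtt{test{:}0}\trianglerighteq T_2)\bullet\alpha$ equals $T_1\bullet\alpha$ if $\alpha(a_i)=0$ and $T_2\bullet\alpha$ otherwise. $R^{\mathcal{M}}_{T,n}\subseteq\mathcal{M}^{\mathit{Var}}$: $R^{\mathcal{M}}_{T,0}=\mathcal{M}^{\mathit{Var}}$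 if $T=\mathsf{S}$, else $\emptyset$; $R^{\mathcal{M}}_{\mathsf{S},n+1}=\mathcal{M}^{\mathit{Var}}$; $R^{\mathcal{M}}_{\mathsf{D},n+1}=\emptyset$; $R^{\mathcal{M}}_{\mathtt{a}\circ T,n+1}=\{\alpha\mid\alpha'\in R^{\mathcal{M}}_{T,n}\}$ for assignments $\mathtt{a}$; $R^{\mathcal{M}}_{T_1\trianglelefteq a_i.\mathtt{test{:}0}\trianglerighteq T_2,n+1}=\{\alpha\in R^{\mathcal{M}}_{T_1,n}\mid\alpha(a_i)=0\}\cup\{\alpha\in R^{\mathcal{M}}_{T_2,n}\mid\alpha(a_i)\neq0\}$. -}

module Defs where

open import Level using (Level; _⊔_; Lift; lift) renaming (suc to lsuc)
open import Algebra.Bundles using (CommutativeRing)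
open import Data.Nat using (ℕ; zero; suc; _≟_)
open import Data.Unit using (⊤)
open import Data.Empty using (⊥)
open import Data.Product using (_×_; ∃)
open import Data.Sum using (_⊎_)
open import Data.List using (List; []; _∷_)
open import Data.Bool using (Bool; true; false)
open import Data.List.Relation.Unary.Any using (Any)
open import Relation.Nullary using (¬_; yes; no)
open import Relation.Binary.PropositionalEquality using (_≡_)

-- Equality is the setoid
-- equality of the ring bundle, so ⁻¹ is required to respect it.

record Meadow (c ℓ : Level) : Set (lsuc (c ⊔ ℓ)) where
  field
    commutativeRing : CommutativeRing c ℓ
  open CommutativeRing commutativeRing public
  field
    _⁻¹           : Carrier → Carrier
    ⁻¹-cong       : ∀ {x y} → x ≈ y → x ⁻¹ ≈ y ⁻¹
    ⁻¹-involutive : ∀ x → (x ⁻¹) ⁻¹ ≈ x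
    ⁻¹-RIL        : ∀ x → x * (x * x ⁻¹) ≈ x

data Var : Set where
  x : ℕ → Var
  a : ℕ → Var
  y : Var

-- Assignments (the first ℕ argument is the index i of the target a_i)
data Assignment : Set where
  cp    : ℕ → ℕ → Assignment
  set0  : ℕ → Assignment
  set1  : ℕ → Assignment
  setai : ℕ → Assignment
  setmi : ℕ → Assignment
  seta  : ℕ → ℕ → Assignment
  setm  : ℕ → ℕ → Assignment
  ycp   : ℕ → Assignment

-- Threads: possibly infinite binary trees  S | D | T₁ ⊴ 𝚊 ⊵ T₂,
-- where assignments only occur in the form  𝚊 ∘ T  (= T ⊴ 𝚊 ⊵ T) and
-- tests are a_i.test:0.
--
-- A possibly infinite tree is represented by its labelling function on
-- positions: a position is a list of directions from the root, and the
-- tree assigns a node label to every position.  At a test node the left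
-- subtree T₁ is in direction true and the right subtree T₂ in direction
-- false; an assignment node 𝚊 ∘ T has the single subtree T in direction
-- true.  Labels at positions that are not reachable from the root are
-- irrelevant; equality of threads (_≈ₜ_ below) ignores them.

data Node : Set where
  S   : Node
  D   : Node
  asg : Assignment → Node
  tst : ℕ → Node

Position : Set
Position = List Bool

Thread : Set
Thread = Position → Node

root : Thread → Node
root T = T []

child : Bool → Thread → Thread
child d T p = T (d ∷ p)

data FThread : Set where
  S   : FThread
  D   : FThread
  asg : Assignment → FThread → FThread
  tst : ℕ → FThread → FThread → FThread

π : ℕ → Thread → FThread
π zero    T = D
π (suc n) T with root T
... | S     = S
... | D     = D
... | asg 𝚊 = asg 𝚊 (π n (child true T))
... | tst i = tst i (π n (child true T)) (π n (child false T))

-- Equality of threads as trees: they agree on all finite projections,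
-- i.e. on all labels reachable from the root.
_≈ₜ_ : Thread → Thread → Set
T ≈ₜ U = ∀ n → π n T ≡ π n U

data Subthread : Thread → Thread → Set where
  here : ∀ {T} → Subthread T T
  asg  : ∀ {T U 𝚊} → root T ≡ asg 𝚊 → Subthread (child true T) U →
         Subthread T U
  tstˡ : ∀ {T U i} → root T ≡ tst i → Subthread (child true T) U →
         Subthread T U
  tstʳ : ∀ {T U i} → root T ≡ tst i → Subthread (child false T) U →
         Subthread T U

Regular : Thread → Set
Regular T = ∃ λ (Ts : List Thread) → ∀ U → Subthread T U → Any (U ≈ₜ_) Ts

module Semantics {c ℓ} (M : Meadow c ℓ) where
  open Meadow M

  State : Set c
  State = Var → Carrier

  updA : State → ℕ → Carrier → State
  updA α i m (a j) with i ≟ j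
  ... | yes _ = m
  ... | no  _ = α (a j)
  updA α i m v = α v

  updY : State → Carrier → State
  updY α m y = m
  updY α m v = α v

  eff : Assignment → State → State
  eff (cp i j)   α = updA α i (α (x j))
  eff (set0 i)   α = updA α i 0#
  eff (set1 i)   α = updA α i 1#
  eff (setai i)  α = updA α i (- α (a i))
  eff (setmi i)  α = updA α i (α (a i) ⁻¹)
  eff (seta i j) α = updA α i (α (a i) + α (a j))
  eff (setm i j) α = updA α i (α (a i) * α (a j))
  eff (ycp j)    α = updY α (α (a j))

  data Result : Set c where
    ok  : State → Result
    div : Result

  -- The apply operator T • ρ on finite threads, as its graph
  -- (T • ρ ⇓ r  means  T • ρ = r).
  data _•_⇓_ : FThread → Result → Result → Set (c ⊔ ℓ) where
    onD  : ∀ {T} → T • div ⇓ div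
    S⇓   : ∀ {α} → S • ok α ⇓ ok α
    D⇓   : ∀ {α} → D • ok α ⇓ div
    asg⇓ : ∀ {𝚊 T α r} → T • ok (eff 𝚊 α) ⇓ r → asg 𝚊 T • ok α ⇓ r
    tst⇓₀ : ∀ {i T₁ T₂ α r} → α (a i) ≈ 0# → T₁ • ok α ⇓ r →
            tst i T₁ T₂ • ok α ⇓ r
    tst⇓₁ : ∀ {i T₁ T₂ α r} → ¬ (α (a i) ≈ 0#) → T₂ • ok α ⇓ r →
            tst i T₁ T₂ • ok α ⇓ r

  R : Thread → ℕ → State → Set ℓ
  R T zero α with root T
  ... | S = Lift ℓ ⊤
  ... | _ = Lift ℓ ⊥
  R T (suc n) α with root T
  ... | S     = Lift ℓ ⊤
  ... | D     = Lift ℓ ⊥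
  ... | asg 𝚊 = R (child true T) n (eff 𝚊 α)
  ... | tst i = (α (a i) ≈ 0# × R (child true T) n α)
              ⊎ (¬ (α (a i) ≈ 0#) × R (child false T) n α)

-- The bound R_{T,n} forces every run from α to reach S within the first n
-- steps, along a path that only depends on the tests actually taken.  Any
-- projection π_k T with k > n contains that whole path and differs from T
-- only below depth n, where the run never goes; so all these projections
-- reach S, with the same final state.
module Submission where

open import Defs
open import Data.Nat using (ℕ; suc; zero; _<_; s≤s)
open import Data.Nat.Properties using (≤-refl)
open import Data.Product using (_×_; ∃; _,_)
open import Data.Sum using (inj₁; inj₂)
open import Data.Bool using (true; false)
open import Relation.Nullary using (¬_; contradiction)
open import Function.Bundles using (_⇔_; mk⇔)

module ProjectionSemantics {c ℓ} (M : Meadow c ℓ) where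
  open Meadow M
  open Semantics M

  asg⇓-inv : ∀ {𝚊 T α r} → asg 𝚊 T • ok α ⇓ r → T • ok (eff 𝚊 α) ⇓ r
  asg⇓-inv (asg⇓ p) = p

  tst⇓-inv₀ : ∀ {i T₁ T₂ α r} → α (a i) ≈ 0# →
              tst i T₁ T₂ • ok α ⇓ r → T₁ • ok α ⇓ r
  tst⇓-inv₀ z (tst⇓₀ _ p)  = p
  tst⇓-inv₀ z (tst⇓₁ nz _) = contradiction z nz

  tst⇓-inv₁ : ∀ {i T₁ T₂ α r} → ¬ (α (a i) ≈ 0#) →
              tst i T₁ T₂ • ok α ⇓ r → T₂ • ok α ⇓ r
  tst⇓-inv₁ nz (tst⇓₁ _ p) = p
  tst⇓-inv₁ nz (tst⇓₀ z _) = contradiction z nz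

  R⇒π-suc-terminates : ∀ T n α → R T n α → ∃ λ β → π (suc n) T • ok α ⇓ ok β
  R⇒π-suc-terminates T zero α r with root T
  ... | S = α , S⇓
  R⇒π-suc-terminates T (suc n) α r with root T
  ... | S = α , S⇓
  ... | asg 𝚊 with R⇒π-suc-terminates (child true T) n (eff 𝚊 α) r
  ...   | β , p = β , asg⇓ p
  R⇒π-suc-terminates T (suc n) α (inj₁ (z , r)) | tst i
    with R⇒π-suc-terminates (child true T) n α r
  ... | β , p = β , tst⇓₀ z p
  R⇒π-suc-terminates T (suc n) α (inj₂ (nz , r)) | tst i
    with R⇒π-suc-terminates (child false T) n α r
  ... | β , p = β , tst⇓₁ nz p

  R⇒π-transfer : ∀ T n α → R T n α → ∀ j k → n < j → n < k → ∀ r →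
                 π j T • ok α ⇓ r → π k T • ok α ⇓ r
  R⇒π-transfer T zero α _ (suc j) (suc k) _ _ r p with root T
  ... | S = p
  R⇒π-transfer T (suc n) α rel (suc j) (suc k) (s≤s n<j) (s≤s n<k) r p
    with root T | rel
  ... | S     | _ = p
  ... | asg 𝚊 | rel′ =
    asg⇓ (R⇒π-transfer (child true T) n (eff 𝚊 α) rel′ j k n<j n<k r (asg⇓-inv p))
  ... | tst i | inj₁ (z , rel′) =
    tst⇓₀ z (R⇒π-transfer (child true T) n α rel′ j k n<j n<k r (tst⇓-inv₀ z p))
  ... | tst i | inj₂ (nz , rel′) =
    tst⇓₁ nz (R⇒π-transfer (child false T) n α rel′ j k n<j n<k r (tst⇓-inv₁ nz p))

  R⇒π-stable : ∀ T n α → R T n α → ∀ j k → n < j → n < k → ∀ r →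
               π j T • ok α ⇓ r ⇔ π k T • ok α ⇓ r
  R⇒π-stable T n α rel j k n<j n<k r =
    mk⇔ (R⇒π-transfer T n α rel j k n<j n<k r)
        (R⇒π-transfer T n α rel k j n<k n<j r)

mainTheorem10 : ∀ {c ℓ} (M : Meadow c ℓ) (T : Thread) → Regular T →
    ∀ (n : ℕ) (α : Semantics.State M) → Semantics.R M T n α →
      (∃ λ β → Semantics._•_⇓_ M (π (suc n) T) (Semantics.ok α) (Semantics.ok β))
      × (∀ k → n < k → ∀ r →
           Semantics._•_⇓_ M (π k T) (Semantics.ok α) r
             ⇔ Semantics._•_⇓_ M (π (suc n) T) (Semantics.ok α) r)
mainTheorem10 M T _ n α rel =
  R⇒π-suc-terminates T n α rel ,
  λ k n<k → R⇒π-stable T n α rel k (suc n) n<k ≤-refl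
  where open ProjectionSemantics M
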